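{- For every hypergraph $\mathcal{H}$, $\mathrm{hd}(\mathcal{H})\le\mathrm{shd}(\mathcal{H})\le\mathrm{hd}(\mathcal{H})+1$.
   Context: A hypergraph is a triple $\mathcal{H}=(V(\mathcal{H}),E(\mathcal{H}),\beta_{\mathcal{H}})$ with disjoint finite sets $V(\mathcal{H}),E(\mathcal{H})$ and a total function $\beta_{\mathcal{H}}\colon E(\mathcal{H})\to\mathcal{P}(V(\mathcal{H}))$ with $V(\mathcal{H})=\bigcup_e\beta_{\mathcal{H}}(e)$. Its incidence graph $\mathcal{I}_{\mathcal{H}}$ has red vertices $V(\mathcal{H})$, blue vertices $E(\mathcal{H})$ and edges $(e,v)$ for $v\in\beta_{\mathcal{H}}(e)$; for a blue vertex $e$ write $\beta(e)$ for its set of red neighbours. A rooted forest $F$ is a disjoint union of rooted trees; $\le_F$ is the partial order with roots minimal and $s\le_F t$ iff $s$ lies on the path from $t$ to its root. $P(s,t)$ is the set of nodes on the path from $s$ to $t$ (inclusive; empty if no path exists), $P(s)$ the set of nodes on the path from $s$ to its root; $\mathrm{lcv}(s,t)$ is the $\le_F$-maximum of $P(s)\cap P(t)$, defined iff $s,t$ are in the same tree. $\mathrm{level}(s)=|P(s)|$; the height of $F$ is the maximum level. An elimination forest of $\mathcal{I}_{\mathcal{H}}$ is a pair $(F,\Gamma)$ with $F$ a rooted forest and $\Gamma\colon V(F)\to E(\mathcal{H})$ such that, writing $\hat\Gamma(t)=\beta(\Gamma(t))$: (1) every vertex lies in some $\hat\Gamma(t)$; (2) for every hyperedge $e$ there are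 $s\le_F t$ with $\beta(e)\subseteq\bigcup_{p\in P(s,t)}\hat\Gamma(p)$; (3) whenever $\hat\Gamma(s)\cap\hat\Gamma(t)\neq\emptyset$, $\mathrm{lcv}(s,t)$ is defined and $\hat\Gamma(s)\cap\hat\Gamma(t)\subseteq\bigcup_{p\in P(\mathrm{lcv}(s,t))}\hat\Gamma(p)$. It is strict if $\Gamma$ is bijective. The hypertree depth $\mathrm{hd}(\mathcal{H})$ (resp. strict hypertree depth $\mathrm{shd}(\mathcal{H})$) is the minimum height of an elimination forest (resp. strict elimination forest) of $\mathcal{I}_{\mathcal{H}}$. -}

module Defs where

open import Data.Nat using (ℕ; zero; suc; _⊔_; _≤_)
open import Data.Fin using (Fin)
open import Data.Fin.Subset using (Subset; _∈_)
open import Data.Maybe using (Maybe; just; nothing; _>>=_)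
open import Data.List using (foldr; map; allFin)
open import Data.Product using (Σ; ∃; _×_; _,_)
open import Function.Definitions using (Bijective)
open import Relation.Binary.PropositionalEquality using (_≡_)

-- Hypergraphs: vertices Fin n, hyperedges Fin m (disjoint by typing),
-- β e ⊆ V, and every vertex lies in some hyperedge (V = ⋃ β(e)).

record Hypergraph : Set where
  field
    n     : ℕ
    m     : ℕ
    β     : Fin m → Subset n
    cover : ∀ (v : Fin n) → ∃ λ (e : Fin m) → v ∈ β e

-- Rooted forests on the nodes Fin k, given by a parent map
-- (nothing = root), with no cycles: the k-th ancestor of any node
-- does not exist.

anc : ∀ {k} → (Fin k → Maybe (Fin k)) → ℕ → Fin k → Maybe (Fin k)
anc par zero    t = just t
anc par (suc i) t = anc par i t >>= par

record RootedForest (k : ℕ) : Set where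
  field
    parent  : Fin k → Maybe (Fin k)
    acyclic : ∀ (t : Fin k) → anc parent k t ≡ nothing

module _ {k : ℕ} (F : RootedForest k) where
  open RootedForest F

  _≤F_ : Fin k → Fin k → Set
  s ≤F t = ∃ λ (i : ℕ) → anc parent i t ≡ just s

  IsLcv : Fin k → Fin k → Fin k → Set
  IsLcv s t l = (l ≤F s) × (l ≤F t) ×
                (∀ (p : Fin k) → p ≤F s → p ≤F t → p ≤F l)

  depth : ℕ → Maybe (Fin k) → ℕ
  depth zero    _        = zero
  depth (suc f) nothing  = zero
  depth (suc f) (just t) = suc (depth f (parent t))

  -- level(t) = |P(t)| (fuel k suffices by acyclicity)
  level : Fin k → ℕ
  level t = depth k (just t)

  height : ℕ
  height = foldr _⊔_ 0 (map level (allFin k))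

-- Elimination forests of the incidence graph of H.

record EliminationForest (H : Hypergraph) : Set where
  open Hypergraph H
  field
    k      : ℕ
    forest : RootedForest k
    Γ      : Fin k → Fin m
  -- v ∈ Γ̂(t)  ⇔  v ∈ β (Γ t)
  field
    covers   : ∀ (v : Fin n) → ∃ λ (t : Fin k) → v ∈ β (Γ t)
    edges    : ∀ (e : Fin m) → Σ (Fin k) λ s → Σ (Fin k) λ t →
                 _≤F_ forest s t ×
                 (∀ (v : Fin n) → v ∈ β e →
                    ∃ λ (p : Fin k) → _≤F_ forest s p × _≤F_ forest p t × v ∈ β (Γ p))
    overlaps : ∀ (s t : Fin k) (v : Fin n) → v ∈ β (Γ s) → v ∈ β (Γ t) →
                 ∃ λ (l : Fin k) → IsLcv forest s t l ×
                   (∀ (w : Fin n) → w ∈ β (Γ s) → w ∈ β (Γ t) →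
                      ∃ λ (p : Fin k) → _≤F_ forest p l × w ∈ β (Γ p))

efHeight : ∀ {H} → EliminationForest H → ℕ
efHeight EF = height (EliminationForest.forest EF)

IsStrict : ∀ {H} → EliminationForest H → Set
IsStrict EF = Bijective _≡_ _≡_ (EliminationForest.Γ EF)

IsHd : Hypergraph → ℕ → Set
IsHd H d = (∃ λ (EF : EliminationForest H) → efHeight EF ≡ d) ×
           (∀ (EF : EliminationForest H) → d ≤ efHeight EF)

IsShd : Hypergraph → ℕ → Set
IsShd H d = (∃ λ (EF : EliminationForest H) → IsStrict EF × efHeight EF ≡ d) ×
            (∀ (EF : EliminationForest H) → IsStrict EF → d ≤ efHeight EF)

-- hd ≤ shd holds because strict elimination forests are elimination forests. Conversely, take an
-- elimination forest of height hd. If two nodes carry the same hyperedge, condition (3) shows that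
-- the bag of one of them is covered by the bags of its strict ancestors, so that node can be
-- contracted into its parent without increasing the height; repeating this makes Γ injective.
-- Each hyperedge outside the image of Γ is then hung as a leaf below a node under which, by
-- condition (2), its vertices are covered. The result is strict and at most one level higher.
-- The minima hd and shd exist constructively because, after removing duplicates, forests with at
-- most |E(H)| nodes suffice, and over those "some forest of height ≤ d" is a finite search.
module Submission where

open import Defs
open import Data.Nat
  using (ℕ; zero; suc; pred; >-nonZero; _≤_; _<_; _+_; _⊔_; z≤n; s≤s; _≤′_; ≤′-refl; ≤′-step)
import Data.Nat.Properties as ℕ
open import Data.Nat.Induction using (<-rec)
open import Data.Fin as Fin using (Fin; punchIn; punchOut; toℕ; inject₁)
import Data.Fin.Properties as Fin
open import Data.Fin.Subset using (_∈_)
open import Data.Fin.Subset.Properties using (_∈?_)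
open import Data.Maybe using (Maybe; just; nothing; _>>=_; _<∣>_; fromMaybe) renaming (map to mapMaybe)
open import Data.Maybe.Properties using (just-injective) renaming (≡-dec to ≡-decMaybe)
open import Data.Product using (Σ; ∃; ∃₂; _×_; _,_; proj₁; proj₂)
open import Data.Sum using (_⊎_; inj₁; inj₂)
open import Data.Empty using (⊥-elim)
open import Data.Unit using (⊤; tt)
open import Data.List using (foldr; map; allFin) renaming ([] to []ₗ; _∷_ to _∷ₗ_)
import Data.List.Properties as List
open import Data.List.Membership.Propositional using () renaming (_∈_ to _∈ₗ_)
open import Data.List.Membership.Propositional.Properties using (∈-allFin)
open import Data.List.Relation.Unary.Any using (here; there)
open import Data.Vec.Functional using (_∷_; head; tail)
open import Function using (_∘_; id; case_of_)
open import Function.Definitions using (Bijective; Injective)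
import Function.Construct.Identity as Identity
open import Relation.Binary.PropositionalEquality
open import Relation.Binary.Construct.Closure.ReflexiveTransitive using (Star; ε; _◅_; _◅◅_) renaming (map to mapStar)
open import Relation.Nullary using (Dec; yes; no; ¬_)
open import Relation.Nullary.Decidable using (map′; ¬?; _×-dec_; _→-dec_; _⊎-dec_)
open import Relation.Unary using (Decidable)

Searchable : Set → Set₁
Searchable A = ∀ {P : A → Set} → Decidable P → Dec (∃ P)

Maybe-searchable : ∀ {A} → Searchable A → Searchable (Maybe A)
Maybe-searchable search {P} P? = map′ from to (P? nothing ⊎-dec search (P? ∘ just))
  where
  from : P nothing ⊎ ∃ (P ∘ just) → ∃ P
  from (inj₁ p)       = nothing , p
  from (inj₂ (a , p)) = just a , p
  to : ∃ P → P nothing ⊎ ∃ (P ∘ just)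
  to (nothing , p) = inj₁ p
  to (just a , p)  = inj₂ (a , p)

search-functions : ∀ {A} → Searchable A → ∀ k {P : (Fin k → A) → Set} →
                   (∀ {f g} → f ≗ g → P f → P g) → Decidable P → Dec (∃ P)
search-functions {A} search zero resp P? =
  map′ (λ p → empty , p) (λ (f , p) → resp (λ ()) p) (P? empty)
  where
  empty : Fin 0 → A
  empty ()
search-functions search (suc k) {P} resp P? =
  map′ from to (search λ a → search-functions search k (resp ∘ ∷-cong a) (P? ∘ (a ∷_)))
  where
  ∷-cong : ∀ a {f g} → f ≗ g → a ∷ f ≗ a ∷ g
  ∷-cong a f≗g Fin.zero    = refl
  ∷-cong a f≗g (Fin.suc i) = f≗g i
  from : ∃ (λ a → ∃ λ f → P (a ∷ f)) → ∃ P
  from (a , f , p) = a ∷ f , p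
  to : ∃ P → ∃ (λ a → ∃ λ f → P (a ∷ f))
  to (f , p) = head f , tail f , resp head∷tail p
    where
    head∷tail : f ≗ head f ∷ tail f
    head∷tail Fin.zero    = refl
    head∷tail (Fin.suc i) = refl

Least : (ℕ → Set) → ℕ → Set
Least P d = P d × (∀ {d′} → P d′ → d ≤ d′)

least : ∀ {P : ℕ → Set} → Decidable P → ∀ {N} → P N → ∃ (Least P)
least {P} P? = <-rec (λ N → P N → ∃ (Least P)) step _
  where
  step : ∀ N → (∀ {M} → M < N → P M → ∃ (Least P)) → P N → ∃ (Least P)
  step N rec pN with ℕ.anyUpTo? P? N
  ... | yes (M , M<N , pM) = rec M<N pM
  ... | no none = N , pN , λ pM → ℕ.≮⇒≥ λ M<N → none (_ , M<N , pM)

module Ancestry {k : ℕ} (parent : Fin k → Maybe (Fin k)) where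

  Parent : Fin k → Fin k → Set
  Parent a b = parent a ≡ just b

  infix 4 _≼_
  _≼_ : Fin k → Fin k → Set
  a ≼ b = Star Parent b a

  Acyclic : Set
  Acyclic = ∀ t → anc parent k t ≡ nothing

  NoCycle : Set
  NoCycle = ∀ {a b} → Parent a b → ¬ a ≼ b

  ≼-trans : ∀ {a b c} → a ≼ b → b ≼ c → a ≼ c
  ≼-trans a≼b b≼c = b≼c ◅◅ a≼b

  parent-≼ : ∀ {a b} → Parent a b → b ≼ a
  parent-≼ e = e ◅ ε

  ≼-inv : ∀ {p x} → p ≼ x → p ≡ x ⊎ ∃ λ q → Parent x q × p ≼ q
  ≼-inv ε       = inj₁ refl
  ≼-inv (e ◅ r) = inj₂ (_ , e , r)

  ≼-root : ∀ {p x} → parent x ≡ nothing → p ≼ x → p ≡ x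
  ≼-root e ε = refl
  ≼-root e (e′ ◅ r) with () ← trans (sym e) e′

  ≼-comparable : ∀ {a b t} → a ≼ t → b ≼ t → a ≼ b ⊎ b ≼ a
  ≼-comparable ε        b≼t      = inj₂ b≼t
  ≼-comparable (e ◅ r)  ε        = inj₁ (e ◅ r)
  ≼-comparable (e ◅ r)  (e′ ◅ r′) with refl ← trans (sym e) e′ = ≼-comparable r r′

  anc-parent : ∀ {t t′} → Parent t t′ → ∀ i → anc parent (suc i) t ≡ anc parent i t′
  anc-parent e zero    = e
  anc-parent e (suc i) = cong (_>>= parent) (anc-parent e i)

  anc-root : ∀ {t} → parent t ≡ nothing → ∀ i → anc parent (suc i) t ≡ nothing
  anc-root e zero    = e
  anc-root e (suc i) = cong (_>>= parent) (anc-root e i)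

  anc-suc : ∀ i {t s} → anc parent (suc i) t ≡ just s →
            ∃ λ b → Parent t b × anc parent i b ≡ just s
  anc-suc i {t} e with parent t in eq
  ... | nothing with () ← trans (sym (anc-root eq i)) e
  ... | just b = b , refl , trans (sym (anc-parent eq i)) e

  anc⇒≼ : ∀ i {t s} → anc parent i t ≡ just s → s ≼ t
  anc⇒≼ zero    refl = ε
  anc⇒≼ (suc i) {t} e with anc parent i t in eq
  ... | just w = anc⇒≼ i eq ◅◅ (e ◅ ε)

  ≼⇒anc : ∀ {s t} → s ≼ t → ∃ λ i → anc parent i t ≡ just s
  ≼⇒anc ε = 0 , refl
  ≼⇒anc (e ◅ r) with i , eq ← ≼⇒anc r = suc i , trans (anc-parent e i) eq

  anc-+ : ∀ i d t → anc parent (i + d) t ≡ (anc parent i t >>= anc parent d)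
  anc-+ i zero t rewrite ℕ.+-identityʳ i with anc parent i t
  ... | nothing = refl
  ... | just w  = refl
  anc-+ i (suc d) t rewrite ℕ.+-suc i d | anc-+ i d t with anc parent i t
  ... | nothing = refl
  ... | just w  = refl

  anc-nothing-mono : ∀ {i j t} → i ≤ j → anc parent i t ≡ nothing → anc parent j t ≡ nothing
  anc-nothing-mono i≤j = go (ℕ.≤⇒≤′ i≤j)
    where
    go : ∀ {i j t} → i ≤′ j → anc parent i t ≡ nothing → anc parent j t ≡ nothing
    go ≤′-refl     e = e
    go (≤′-step p) e = cong (_>>= parent) (go p e)

  acyclic⇒noCycle : Acyclic → NoCycle
  acyclic⇒noCycle acyclic {a} {b} a→b a≼b =
    case trans (sym (acyclic a)) (proj₂ (proj₂ (around k))) of λ ()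
    where
    around : ∀ i → ∃ λ w → a ≼ w × anc parent i a ≡ just w
    around zero = a , ε , refl
    around (suc i) with around i
    ... | w , ε       , eq = b , a≼b , trans (cong (_>>= parent) eq) a→b
    ... | w , e ◅ a≼w , eq = _ , a≼w , trans (cong (_>>= parent) eq) e

  anc-k⇒cycle : ∀ {t z} → anc parent k t ≡ just z → ∃₂ λ a d → anc parent (suc d) a ≡ just a
  anc-k⇒cycle {t} ancₖ =
    let i , j , i<j , same = Fin.pigeonhole (ℕ.n<1+n k) node
        d , i+1+d≡j        = ℕ.m≤n⇒∃[o]m+o≡n i<j
    in node i , d , cycle i j d (trans (ℕ.+-suc (toℕ i) d) i+1+d≡j) same
    where
    node : Fin (suc k) → Fin k
    node i = fromMaybe t (anc parent (toℕ i) t)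

    node-anc : ∀ i → anc parent (toℕ i) t ≡ just (node i)
    node-anc i with anc parent (toℕ i) t in ancᵢ
    ... | just _  = refl
    ... | nothing with () ← trans (sym ancₖ)
                              (anc-nothing-mono (ℕ.≤-pred (Fin.toℕ<n i)) ancᵢ)

    cycle : ∀ i j d → toℕ i + suc d ≡ toℕ j → node i ≡ node j →
            anc parent (suc d) (node i) ≡ just (node i)
    cycle i j d i+d≡j same = begin
      anc parent (suc d) (node i)                  ≡⟨ cong (_>>= anc parent (suc d)) (node-anc i) ⟨
      (anc parent (toℕ i) t >>= anc parent (suc d)) ≡⟨ anc-+ (toℕ i) (suc d) t ⟨
      anc parent (toℕ i + suc d) t                 ≡⟨ cong (λ n → anc parent n t) i+d≡j ⟩
      anc parent (toℕ j) t                         ≡⟨ node-anc j ⟩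
      just (node j)                                ≡⟨ cong just same ⟨
      just (node i)                                ∎
      where open ≡-Reasoning

  noCycle⇒acyclic : NoCycle → Acyclic
  noCycle⇒acyclic noCycle t with anc parent k t in ancₖ
  ... | nothing = refl
  ... | just _ =
    let a , d , loop       = anc-k⇒cycle ancₖ
        b , a→b , d-to-a   = anc-suc d loop
    in ⊥-elim (noCycle a→b (anc⇒≼ d d-to-a))

  anc-bound : Acyclic → ∀ i {t s} → anc parent i t ≡ just s → i < k
  anc-bound acyclic i {t} e with i ℕ.<? k
  ... | yes i<k = i<k
  ... | no  i≮k with () ← trans (sym e) (anc-nothing-mono (ℕ.≮⇒≥ i≮k) (acyclic t))

  ≼-dec : Acyclic → ∀ s t → Dec (s ≼ t)
  ≼-dec acyclic s t =
    map′ (λ (i , _ , e) → anc⇒≼ i e)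
         (λ s≼t → let i , e = ≼⇒anc s≼t in i , anc-bound acyclic i e , e)
         (ℕ.anyUpTo? (λ i → ≡-decMaybe Fin._≟_ (anc parent i t) (just s)) k)

  climb : ℕ → Fin k → Fin k
  climb zero    t = t
  climb (suc f) t with parent t
  ... | nothing = t
  ... | just t′ = climb f t′

  climb-≼ : ∀ f t → climb f t ≼ t × (parent (climb f t) ≡ nothing ⊎ anc parent f t ≡ just (climb f t))
  climb-≼ zero    t = ε , inj₂ refl
  climb-≼ (suc f) t with parent t in e
  ... | nothing = ε , inj₁ e
  ... | just t′ with climb-≼ f t′
  ...   | c≼t′ , inj₁ isRoot = ≼-trans c≼t′ (parent-≼ e) , inj₁ isRoot
  ...   | c≼t′ , inj₂ reach  = ≼-trans c≼t′ (parent-≼ e) , inj₂ (trans (anc-parent e f) reach)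

  root : Fin k → Fin k
  root = climb k

  root-≼ : ∀ t → root t ≼ t
  root-≼ t = proj₁ (climb-≼ k t)

  root-isRoot : Acyclic → ∀ t → parent (root t) ≡ nothing
  root-isRoot acyclic t with climb-≼ k t
  ... | _ , inj₁ isRoot = isRoot
  ... | _ , inj₂ reach with () ← trans (sym (acyclic t)) reach

  root-minimal : Acyclic → ∀ {p t} → p ≼ t → root t ≼ p
  root-minimal acyclic {p} {t} p≼t with ≼-comparable p≼t (root-≼ t)
  ... | inj₂ r≼p = r≼p
  ... | inj₁ p≼r with refl ← ≼-root (root-isRoot acyclic t) p≼r = ε

  Lcv : Fin k → Fin k → Fin k → Set
  Lcv s t l = l ≼ s × l ≼ t × (∀ p → p ≼ s → p ≼ t → p ≼ l)

  lcv-exists : Acyclic → ∀ {s t c} → c ≼ s → c ≼ t → ∃ (Lcv s t)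
  lcv-exists acyclic {s} ε c≼t = s , ε , c≼t , λ p p≼s _ → p≼s
  lcv-exists acyclic {s} {t} (e ◅ c≼s′) c≼t with ≼-dec acyclic s t
  ... | yes s≼t = s , ε , s≼t , λ p p≼s _ → p≼s
  ... | no  s⋠t with l , l≼s′ , l≼t , greatest ← lcv-exists acyclic c≼s′ c≼t =
    l , ≼-trans l≼s′ (parent-≼ e) , l≼t , greatest′
    where
    greatest′ : ∀ p → p ≼ s → p ≼ t → p ≼ l
    greatest′ p p≼s p≼t with ≼-inv p≼s
    ... | inj₁ refl = ⊥-elim (s⋠t p≼t)
    ... | inj₂ (q , e′ , p≼q) with refl ← trans (sym e) e′ = greatest p p≼q p≼t

module Forest {k : ℕ} (F : RootedForest k) where
  open RootedForest F
  open Ancestry parent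

  private
    suc-pred-k : Fin k → suc (pred k) ≡ k
    suc-pred-k t = ℕ.suc-pred k ⦃ >-nonZero (ℕ.≤-trans (s≤s z≤n) (Fin.toℕ<n t)) ⦄

  depth-nothing : ∀ f → depth F f nothing ≡ 0
  depth-nothing zero    = refl
  depth-nothing (suc f) = refl

  depth-stable : ∀ j f t → anc parent j t ≡ nothing → j ≤ f → depth F f (just t) ≡ depth F j (just t)
  depth-stable (suc j) (suc f) t e (s≤s j≤f) with parent t in eq
  ... | nothing rewrite depth-nothing f | depth-nothing j = refl
  ... | just t′ = cong suc (depth-stable j f t′ (trans (sym (anc-parent eq j)) e) j≤f)

  level-suc : ∀ t → level F t ≡ suc (depth F (pred k) (parent t))
  level-suc t = cong (λ f → depth F f (just t)) (sym (suc-pred-k t))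

  1≤level : ∀ t → 1 ≤ level F t
  1≤level t = subst (1 ≤_) (sym (level-suc t)) (s≤s z≤n)

  level-parent : ∀ {a b} → Parent a b → level F a ≡ suc (level F b)
  level-parent {a} {b} e = begin
    level F a                         ≡⟨ level-suc a ⟩
    suc (depth F (pred k) (parent a)) ≡⟨ cong (suc ∘ depth F (pred k)) e ⟩
    suc (depth F (pred k) (just b))   ≡⟨ cong suc (depth-stable (pred k) k b b-root-within ℕ.pred[n]≤n) ⟨
    suc (level F b)                   ∎
    where
    open ≡-Reasoning
    b-root-within : anc parent (pred k) b ≡ nothing
    b-root-within = trans (sym (anc-parent e (pred k)))
                          (subst (λ f → anc parent f a ≡ nothing) (sym (suc-pred-k a)) (acyclic a))

  level-mono : ∀ {a b} → a ≼ b → level F a ≤ level F b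
  level-mono ε       = ℕ.≤-refl
  level-mono (e ◅ r) = subst (_ ≤_) (sym (level-parent e)) (ℕ.m≤n⇒m≤1+n (level-mono r))

  level-below-parent : ∀ {a b p} → Parent a b → p ≼ b → level F p < level F a
  level-below-parent e p≼b = subst (_ <_) (sym (level-parent e)) (s≤s (level-mono p≼b))

  level≤rank : (rank : Fin k → ℕ) → (∀ a → 1 ≤ rank a) → (∀ {a b} → Parent a b → rank b < rank a) →
               ∀ a → level F a ≤ rank a
  level≤rank rank rank≥1 rank-< = bound k
    where
    bound : ∀ f a → depth F f (just a) ≤ rank a
    bound zero    a = z≤n
    bound (suc f) a with parent a in eq
    ... | nothing rewrite depth-nothing f = rank≥1 a
    ... | just b  = ℕ.≤-trans (s≤s (bound f b)) (rank-< eq)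

  level≤height : ∀ t → level F t ≤ height F
  level≤height t = go (allFin k) (∈-allFin t)
    where
    go : ∀ ts → t ∈ₗ ts → level F t ≤ foldr _⊔_ 0 (map (level F) ts)
    go (_ ∷ₗ ts) (here refl) = ℕ.m≤m⊔n _ _
    go (u ∷ₗ ts) (there t∈) = ℕ.≤-trans (go ts t∈) (ℕ.m≤n⊔m (level F u) _)

  height-lub : ∀ {h} → (∀ t → level F t ≤ h) → height F ≤ h
  height-lub {h} bound = go (allFin k)
    where
    go : ∀ ts → foldr _⊔_ 0 (map (level F) ts) ≤ h
    go []ₗ        = z≤n
    go (t ∷ₗ ts) = ℕ.⊔-lub (bound t) (go ts)

  ≤F⇒≼ : ∀ {s t} → _≤F_ F s t → s ≼ t
  ≤F⇒≼ (i , e) = anc⇒≼ i e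

  ≼⇒≤F : ∀ {s t} → s ≼ t → _≤F_ F s t
  ≼⇒≤F = ≼⇒anc

anc-resp : ∀ {k} {parent parent′ : Fin k → Maybe (Fin k)} → parent ≗ parent′ →
           ∀ i t → anc parent i t ≡ anc parent′ i t
anc-resp parent≗ zero    t = refl
anc-resp {parent′ = parent′} parent≗ (suc i) t rewrite anc-resp parent≗ i t with anc parent′ i t
... | nothing = refl
... | just w  = parent≗ w

height-resp : ∀ {k} {F F′ : RootedForest k} → RootedForest.parent F ≗ RootedForest.parent F′ →
              height F ≡ height F′
height-resp {k} {F} {F′} parent≗ = cong (foldr _⊔_ 0) (List.map-cong (λ t → depth-resp k (just t)) (allFin k))
  where
  depth-resp : ∀ f mt → depth F f mt ≡ depth F′ f mt
  depth-resp zero    _        = refl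
  depth-resp (suc f) nothing  = refl
  depth-resp (suc f) (just t) rewrite parent≗ t = cong suc (depth-resp f _)

bijective? : ∀ {k m} (f : Fin k → Fin m) → Dec (Bijective _≡_ _≡_ f)
bijective? f = map′ to from (injective? ×-dec surjective?)
  where
  Injective′ = ∀ x y → f x ≡ f y → x ≡ y
  Surjective′ = ∀ y → ∃ λ x → f x ≡ y
  injective? : Dec Injective′
  injective? = Fin.all? λ x → Fin.all? λ y → (f x Fin.≟ f y) →-dec (x Fin.≟ y)
  surjective? : Dec Surjective′
  surjective? = Fin.all? λ y → Fin.any? λ x → f x Fin.≟ y
  to : Injective′ × Surjective′ → Bijective _≡_ _≡_ f
  to (inj , surj) = (λ {x} {y} → inj x y) , λ y → let x , fx≡y = surj y in x , λ { refl → fx≡y }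
  from : Bijective _≡_ _≡_ f → Injective′ × Surjective′
  from (inj , surj) = (λ x y → inj) , λ y → let x , onto = surj y in x , onto refl

bijective-resp : ∀ {k m} {f g : Fin k → Fin m} → f ≗ g → Bijective _≡_ _≡_ f → Bijective _≡_ _≡_ g
bijective-resp {f = f} {g} f≗g (inj , surj) =
  (λ {x} {y} gx≡gy → inj (trans (f≗g x) (trans gx≡gy (sym (f≗g y))))) ,
  λ y → let x , onto = surj y in x , λ {z} z≡x → trans (sym (f≗g z)) (onto z≡x)

module Elimination (H : Hypergraph) where
  open Hypergraph H

  ∈-β-cong : ∀ {e e′ w} → e ≡ e′ → w ∈ β e → w ∈ β e′
  ∈-β-cong refl w∈e = w∈e

  record IsElimination {k : ℕ} (parent : Fin k → Maybe (Fin k)) (Γ : Fin k → Fin m) : Set where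
    constructor isElimination
    open Ancestry parent
    field
      covers         : ∀ v → ∃ λ t → v ∈ β (Γ t)
      coversEdges    : ∀ e → ∃ λ t → ∀ v → v ∈ β e → ∃ λ p → p ≼ t × v ∈ β (Γ p)
      coversOverlaps : ∀ s t v → v ∈ β (Γ s) → v ∈ β (Γ t) →
                       ∃ λ l → Lcv s t l ×
                         (∀ w → w ∈ β (Γ s) → w ∈ β (Γ t) → ∃ λ p → p ≼ l × w ∈ β (Γ p))

  -- The elimination forests of Defs, with ≤_F replaced by the reflexive-transitive closure of the
  -- parent relation and without the lower end s in condition (2): it can always be the root above t.
  record ElimForest : Set where
    constructor elimForest
    field
      {k}         : ℕ
      forest      : RootedForest k
      Γ           : Fin k → Fin m
      elimination : IsElimination (RootedForest.parent forest) Γ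

  toEliminationForest : ElimForest → EliminationForest H
  toEliminationForest (elimForest F Γ (isElimination covers coversEdges coversOverlaps)) = record
    { forest   = F
    ; Γ        = Γ
    ; covers   = covers
    ; edges    = λ e → let t , below = coversEdges e in
                   root t , t , ≼⇒≤F (root-≼ t) ,
                   λ v v∈e → let p , p≼t , v∈p = below v v∈e in
                     p , ≼⇒≤F (root-minimal acyclic p≼t) , ≼⇒≤F p≼t , v∈p
    ; overlaps = λ s t v v∈s v∈t →
                   let l , (l≼s , l≼t , greatest) , below = coversOverlaps s t v v∈s v∈t in
                   l , (≼⇒≤F l≼s , ≼⇒≤F l≼t , λ p p≤s p≤t → ≼⇒≤F (greatest p (≤F⇒≼ p≤s) (≤F⇒≼ p≤t))) ,
                   λ w w∈s w∈t → let p , p≼l , w∈p = below w w∈s w∈t in p , ≼⇒≤F p≼l , w∈p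
    }
    where
    open RootedForest F
    open Ancestry parent
    open Forest F

  fromEliminationForest : EliminationForest H → ElimForest
  fromEliminationForest E = elimForest forest Γ record
    { covers         = covers
    ; coversEdges    = λ e → let _ , t , _ , between = edges e in
                         t , λ v v∈e → let p , _ , p≤t , v∈p = between v v∈e in p , ≤F⇒≼ p≤t , v∈p
    ; coversOverlaps = λ s t v v∈s v∈t →
                         let l , (l≤s , l≤t , greatest) , below = overlaps s t v v∈s v∈t in
                         l , (≤F⇒≼ l≤s , ≤F⇒≼ l≤t , λ p p≼s p≼t → ≤F⇒≼ (greatest p (≼⇒≤F p≼s) (≼⇒≤F p≼t))) ,
                         λ w w∈s w∈t → let p , p≤l , w∈p = below w w∈s w∈t in p , ≤F⇒≼ p≤l , w∈p
    }
    where
    open EliminationForest E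
    open Forest forest

  module Deletion {j : ℕ} (F : RootedForest (suc j)) (Γ : Fin (suc j) → Fin m)
                  (elimination : IsElimination (RootedForest.parent F) Γ) where
    open RootedForest F
    open Ancestry parent
    open Forest F
    open IsElimination elimination

    Redundant : Fin (suc j) → Set
    Redundant x = ∀ v → v ∈ β (Γ x) → ∃ λ p → (∃ λ q → Parent x q × p ≼ q) × v ∈ β (Γ p)

    redundant-below : ∀ {s q l} → Parent s q → l ≼ q →
                      (∀ w → w ∈ β (Γ s) → ∃ λ p → p ≼ l × w ∈ β (Γ p)) → Redundant s
    redundant-below s→q l≼q below w w∈s =
      let p , p≼l , w∈p = below w w∈s in p , (_ , s→q , ≼-trans p≼l l≼q) , w∈p

    duplicate-redundant : ∀ {s t} → s ≢ t → Γ s ≡ Γ t → ∃₂ λ x y → x ≢ y × Redundant x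
    duplicate-redundant {s} {t} s≢t Γs≡Γt with Fin.any? (λ v → v ∈? β (Γ s))
    ... | no empty = s , t , s≢t , λ v v∈s → ⊥-elim (empty (v , v∈s))
    ... | yes (v , v∈s) with l , (l≼s , l≼t , _) , below ← coversOverlaps s t v v∈s (∈-β-cong Γs≡Γt v∈s)
                        with ≼-inv l≼s | ≼-inv l≼t
    ... | inj₂ (q , s→q , l≼q) | _ =
      s , t , s≢t , redundant-below s→q l≼q λ w w∈s → below w w∈s (∈-β-cong Γs≡Γt w∈s)
    ... | inj₁ refl | inj₂ (q , t→q , l≼q) =
      t , s , s≢t ∘ sym , redundant-below t→q l≼q λ w w∈t → below w (∈-β-cong (sym Γs≡Γt) w∈t) w∈t
    ... | inj₁ refl | inj₁ s≡t = ⊥-elim (s≢t s≡t)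

    module _ {x y : Fin (suc j)} (x≢y : x ≢ y) (redundant : Redundant x) where
      private
        noCycle : NoCycle
        noCycle = acyclic⇒noCycle acyclic

      ι : Fin j → Fin (suc j)
      ι = punchIn x

      ι≢x : ∀ a → x ≢ ι a
      ι≢x a = Fin.punchInᵢ≢i x a ∘ sym

      survivor : ∀ {p} → x ≢ p → ∃ λ a → ι a ≡ p
      survivor x≢p = punchOut x≢p , Fin.punchIn-punchOut x≢p

      skip : Fin (suc j) → Maybe (Fin j)
      skip q with x Fin.≟ q
      ... | yes _   = nothing
      ... | no  x≢q = just (punchOut x≢q)

      -- lower y is the nearest ancestor-or-self of y other than x, renumbered into Fin j.
      lower : Fin (suc j) → Maybe (Fin j)
      lower y = skip y <∣> (parent x >>= skip)

      parent′ : Fin j → Maybe (Fin j)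
      parent′ a = parent (ι a) >>= lower

      open Ancestry parent′ using ()
        renaming (_≼_ to _≼′_; ≼-trans to ≼′-trans; Parent to Parent′; NoCycle to NoCycle′; Lcv to Lcv′)

      Γ′ : Fin j → Fin m
      Γ′ = Γ ∘ ι

      skip-just : ∀ {q b} → skip q ≡ just b → ι b ≡ q
      skip-just {q} e with x Fin.≟ q
      ... | no x≢q with refl ← e = Fin.punchIn-punchOut x≢q

      bind-skip : ∀ mq {b} → (mq >>= skip) ≡ just b → ∃ λ q → mq ≡ just q × ι b ≡ q
      bind-skip (just q) e = q , refl , skip-just e

      lower-≢ : ∀ {y} → x ≢ y → lower y ≡ skip y
      lower-≢ {y} x≢y with x Fin.≟ y
      ... | yes x≡y = ⊥-elim (x≢y x≡y)
      ... | no  _   = refl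

      lower-x : lower x ≡ (parent x >>= skip)
      lower-x with x Fin.≟ x
      ... | yes _   = refl
      ... | no  x≢x = ⊥-elim (x≢x refl)

      lower-ι : ∀ a → lower (ι a) ≡ just a
      lower-ι a with x Fin.≟ ι a
      ... | yes x≡ιa = ⊥-elim (ι≢x a x≡ιa)
      ... | no  x≢ιa = cong just (Fin.punchIn-injective x _ _ (Fin.punchIn-punchOut x≢ιa))

      lower-≼ : ∀ {y b} → lower y ≡ just b → ι b ≼ y
      lower-≼ {y} e with x Fin.≟ y
      ... | no x≢y with refl ← e = subst (ι (punchOut x≢y) ≼_) (Fin.punchIn-punchOut x≢y) ε
      ... | yes refl with q , x→q , ιb≡q ← bind-skip (parent x) e = subst (_≼ x) (sym ιb≡q) (parent-≼ x→q)

      parent′-step : ∀ {c y b} → Parent (ι c) y → lower y ≡ just b → Parent′ c b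
      parent′-step c→y lower-y = trans (cong (_>>= lower) c→y) lower-y

      parent′-inv : ∀ {a c} → Parent′ a c → ∃ λ y → Parent (ι a) y × ι c ≼ y
      parent′-inv {a} e with parent (ι a) in a→
      ... | just y = y , refl , lower-≼ e

      ≼-lower-step : ∀ {y y′ b} → Dec (x ≡ y) → Parent y y′ → lower y′ ≡ just b →
                     ∃ λ c → lower y ≡ just c × b ≼′ c
      ≼-lower-step {y′ = y′} {b} (yes refl) x→y′ lower-y′ = b , lower-x′ , ε
        where
        x≢y′ : x ≢ y′
        x≢y′ refl = noCycle x→y′ ε
        lower-x′ : lower x ≡ just b
        lower-x′ = begin
          lower x             ≡⟨ lower-x ⟩
          (parent x >>= skip) ≡⟨ cong (_>>= skip) x→y′ ⟩
          skip y′             ≡⟨ lower-≢ x≢y′ ⟨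
          lower y′            ≡⟨ lower-y′ ⟩
          just b              ∎
          where open ≡-Reasoning
      ≼-lower-step {y} {y′} (no x≢y) y→y′ lower-y′ with c , refl ← survivor x≢y =
        c , lower-ι c , parent′-step y→y′ lower-y′ ◅ ε

      ≼-lower : ∀ {a y} → ι a ≼ y → ∃ λ b → lower y ≡ just b × a ≼′ b
      ≼-lower {a} ε = a , lower-ι a , ε
      ≼-lower {y = y} (y→y′ ◅ ιa≼y′) =
        let b , lower-y′ , a≼b = ≼-lower ιa≼y′
            c , lower-y  , b≼c = ≼-lower-step (x Fin.≟ y) y→y′ lower-y′
        in c , lower-y , ≼′-trans a≼b b≼c

      ≼-lower-≡ : ∀ {a y b} → lower y ≡ just b → ι a ≼ y → a ≼′ b
      ≼-lower-≡ lower-y ιa≼y with b′ , lower-y′ , a≼b′ ← ≼-lower ιa≼y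
                             with refl ← trans (sym lower-y) lower-y′ = a≼b′

      ≼′⇒≼ : ∀ {c a} → c ≼′ a → ι c ≼ ι a
      ≼′⇒≼ ε = ε
      ≼′⇒≼ (e ◅ r) with y , a→y , c≼y ← parent′-inv e =
        ≼-trans (≼′⇒≼ r) (≼-trans c≼y (parent-≼ a→y))

      ≼⇒≼′ : ∀ {a b} → ι a ≼ ι b → a ≼′ b
      ≼⇒≼′ {b = b} = ≼-lower-≡ (lower-ι b)

      noCycle′ : NoCycle′
      noCycle′ e a≼c with y , a→y , c≼y ← parent′-inv e = noCycle a→y (≼-trans (≼′⇒≼ a≼c) c≼y)

      forest′ : RootedForest j
      forest′ = record { parent = parent′ ; acyclic = Ancestry.noCycle⇒acyclic parent′ noCycle′ }

      reroute : ∀ {v p y} → p ≼ y → v ∈ β (Γ p) → ∃ λ a → ι a ≼ y × v ∈ β (Γ′ a)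
      reroute {v} {p} p≼y v∈p with x Fin.≟ p
      ... | no x≢p with a , refl ← survivor x≢p = a , p≼y , v∈p
      ... | yes refl with p′ , (q , x→q , p′≼q) , v∈p′ ← redundant v v∈p
                     with a , refl ← survivor (λ x≡p′ → noCycle x→q (subst (_≼ q) (sym x≡p′) p′≼q)) =
        a , ≼-trans p′≼q (≼-trans (parent-≼ x→q) p≼y) , v∈p′

      cover′ : ∀ {v p y b} → lower y ≡ just b → p ≼ y → v ∈ β (Γ p) → ∃ λ a → a ≼′ b × v ∈ β (Γ′ a)
      cover′ lower-y p≼y v∈p with a , ιa≼y , v∈a ← reroute p≼y v∈p = a , ≼-lower-≡ lower-y ιa≼y , v∈a

      uncovered : ∀ {v p y} → lower y ≡ nothing → p ≼ y → ¬ v ∈ β (Γ p)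
      uncovered lower-y p≼y v∈p with a , ιa≼y , _ ← reroute p≼y v∈p
                                with _ , lower-y′ , _ ← ≼-lower ιa≼y =
        case trans (sym lower-y) lower-y′ of λ ()

      elimination′ : IsElimination parent′ Γ′
      elimination′ = isElimination covers′ coversEdges′ coversOverlaps′
        where
        covers′ : ∀ v → ∃ λ a → v ∈ β (Γ′ a)
        covers′ v with t , v∈t ← covers v with a , _ , v∈a ← reroute {y = t} ε v∈t = a , v∈a

        coversEdges′ : ∀ e → ∃ λ t → ∀ v → v ∈ β e → ∃ λ p → p ≼′ t × v ∈ β (Γ′ p)
        coversEdges′ e with t , below ← coversEdges e with lower t in lower-t
        ... | just b  = b , λ v v∈e → let _ , p≼t , v∈p = below v v∈e in cover′ lower-t p≼t v∈p
        ... | nothing = punchOut x≢y ,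
                        λ v v∈e → let _ , p≼t , v∈p = below v v∈e in ⊥-elim (uncovered lower-t p≼t v∈p)

        coversOverlaps′ : ∀ s t v → v ∈ β (Γ′ s) → v ∈ β (Γ′ t) →
                          ∃ λ l → Lcv′ s t l ×
                            (∀ w → w ∈ β (Γ′ s) → w ∈ β (Γ′ t) → ∃ λ p → p ≼′ l × w ∈ β (Γ′ p))
        coversOverlaps′ s t v v∈s v∈t
          with l , (l≼s , l≼t , greatest) , below ← coversOverlaps (ι s) (ι t) v v∈s v∈t
          with lower l in lower-l
        ... | nothing = let _ , p≼l , v∈p = below v v∈s v∈t in ⊥-elim (uncovered lower-l p≼l v∈p)
        ... | just b  =
          b , (≼⇒≼′ (≼-trans (lower-≼ lower-l) l≼s) , ≼⇒≼′ (≼-trans (lower-≼ lower-l) l≼t) ,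
               λ p p≼s p≼t → ≼-lower-≡ lower-l (greatest (ι p) (≼′⇒≼ p≼s) (≼′⇒≼ p≼t))) ,
          λ w w∈s w∈t → let _ , p≼l , w∈p = below w w∈s w∈t in cover′ lower-l p≼l w∈p

      height′≤height : height forest′ ≤ height F
      height′≤height = Forest.height-lub forest′ λ a →
        ℕ.≤-trans (Forest.level≤rank forest′ (level F ∘ ι) (1≤level ∘ ι) rank-< a) (level≤height (ι a))
        where
        rank-< : ∀ {a c} → Parent′ a c → level F (ι c) < level F (ι a)
        rank-< e with y , a→y , c≼y ← parent′-inv e = level-below-parent a→y c≼y

  elimHeight : ElimForest → ℕ
  elimHeight D = height (ElimForest.forest D)

  IsInjective : ElimForest → Set
  IsInjective D = Injective _≡_ _≡_ (ElimForest.Γ D)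

  duplicate? : ∀ {k} (Γ : Fin k → Fin m) → Dec (∃₂ λ s t → s ≢ t × Γ s ≡ Γ t)
  duplicate? Γ = Fin.any? λ s → Fin.any? λ t → ¬? (s Fin.≟ t) ×-dec (Γ s Fin.≟ Γ t)

  removeDuplicates : ∀ {k} (F : RootedForest k) (Γ : Fin k → Fin m) →
                     IsElimination (RootedForest.parent F) Γ →
                     Σ ElimForest λ D → IsInjective D × elimHeight D ≤ height F
  removeDuplicates F Γ elimination with duplicate? Γ
  ... | no none = elimForest F Γ elimination , injective , ℕ.≤-refl
    where
    injective : Injective _≡_ _≡_ Γ
    injective {s} {t} same with s Fin.≟ t
    ... | yes s≡t = s≡t
    ... | no  s≢t = ⊥-elim (none (s , t , s≢t , same))
  removeDuplicates {suc j} F Γ elimination | yes (s , t , s≢t , same) =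
    let x , y , x≢y , redundant = duplicate-redundant s≢t same
        D , injective , height-D≤ =
          removeDuplicates (forest′ x≢y redundant) (Γ′ x≢y redundant) (elimination′ x≢y redundant)
    in D , injective , ℕ.≤-trans height-D≤ (height′≤height x≢y redundant)
    where open Deletion F Γ elimination

  injectivize : (D : ElimForest) → Σ ElimForest λ D′ → IsInjective D′ × elimHeight D′ ≤ elimHeight D
  injectivize (elimForest F Γ elimination) = removeDuplicates F Γ elimination

  module Strictification {k : ℕ} (F : RootedForest k) (Γ : Fin k → Fin m)
                         (elimination : IsElimination (RootedForest.parent F) Γ)
                         (injective : Injective _≡_ _≡_ Γ) where
    open RootedForest F
    open Ancestry parent
    open Forest F
    open IsElimination elimination

    private
      noCycle : NoCycle
      noCycle = acyclic⇒noCycle acyclic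

    preimage? : ∀ e → Dec (∃ λ x → Γ x ≡ e)
    preimage? e = Fin.any? λ x → Γ x Fin.≟ e

    coveringNode : Fin m → Fin k
    coveringNode e = proj₁ (coversEdges e)

    base : Fin m → Fin k
    base e with preimage? e
    ... | yes (x , _) = x
    ... | no  _       = coveringNode e

    parent′ : Fin m → Maybe (Fin m)
    parent′ e with preimage? e
    ... | yes (x , _) = mapMaybe Γ (parent x)
    ... | no  _       = just (Γ (coveringNode e))

    rank : Fin m → ℕ
    rank e with preimage? e
    ... | yes (x , _) = level F x
    ... | no  _       = suc (level F (coveringNode e))

    open Ancestry parent′ using ()
      renaming (_≼_ to _≼′_; Parent to Parent′; NoCycle to NoCycle′; Lcv to Lcv′)

    base-Γ : ∀ x → base (Γ x) ≡ x
    base-Γ x with preimage? (Γ x)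
    ... | yes (x′ , Γx′≡Γx) = injective Γx′≡Γx
    ... | no  none          = ⊥-elim (none (x , refl))

    parent′-Γ : ∀ x → parent′ (Γ x) ≡ mapMaybe Γ (parent x)
    parent′-Γ x with preimage? (Γ x)
    ... | yes (x′ , Γx′≡Γx) rewrite injective Γx′≡Γx = refl
    ... | no  none          = ⊥-elim (none (x , refl))

    rank-Γ : ∀ x → rank (Γ x) ≡ level F x
    rank-Γ x with preimage? (Γ x)
    ... | yes (x′ , Γx′≡Γx) rewrite injective Γx′≡Γx = refl
    ... | no  none          = ⊥-elim (none (x , refl))

    parent′-leaf : ∀ {e} → ¬ (∃ λ x → Γ x ≡ e) → parent′ e ≡ just (Γ (coveringNode e))
    parent′-leaf {e} none with preimage? e
    ... | yes found = ⊥-elim (none found)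
    ... | no  _     = refl

    mapMaybe-just : ∀ mq {f} → mapMaybe Γ mq ≡ just f → ∃ λ y → mq ≡ just y × f ≡ Γ y
    mapMaybe-just (just y) refl = y , refl , refl

    parent′-Γ-inv : ∀ {x f} → Parent′ (Γ x) f → ∃ λ y → Parent x y × f ≡ Γ y
    parent′-Γ-inv {x} e = mapMaybe-just (parent x) (trans (sym (parent′-Γ x)) e)

    parent′-target : ∀ {e f} → Parent′ e f → ∃ λ y → f ≡ Γ y
    parent′-target {e} p with preimage? e
    ... | yes (x , refl) = let y , _ , f≡Γy = mapMaybe-just (parent x) p in y , f≡Γy
    ... | no  none       = _ , sym (just-injective p)

    Γ-≼′ : ∀ {y x} → y ≼ x → Γ y ≼′ Γ x
    Γ-≼′ ε = ε
    Γ-≼′ {x = x} (e ◅ r) = trans (parent′-Γ x) (cong (mapMaybe Γ) e) ◅ Γ-≼′ r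

    ≼′-Γ : ∀ {f x} → f ≼′ Γ x → ∃ λ y → f ≡ Γ y × y ≼ x
    ≼′-Γ {x = x} ε = x , refl , ε
    ≼′-Γ (p ◅ r) with y , x→y , refl ← parent′-Γ-inv p
                 with z , refl , z≼y ← ≼′-Γ r = z , refl , ≼-trans z≼y (parent-≼ x→y)

    ≼′-inv : ∀ {p′ e} → p′ ≼′ e → p′ ≡ e ⊎ ∃ λ p → p′ ≡ Γ p × p ≼ base e
    ≼′-inv {e = e} r with preimage? e
    ... | yes (x , refl) = inj₂ (≼′-Γ r)
    ≼′-inv ε       | no none = inj₁ refl
    ≼′-inv (s ◅ r) | no none with refl ← just-injective (trans (sym (parent′-leaf none)) s) = inj₂ (≼′-Γ r)

    base-≼′ : ∀ {p e} → p ≼ base e → Γ p ≼′ e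
    base-≼′ {e = e} r with preimage? e
    ... | yes (x , refl) = Γ-≼′ r
    ... | no  none       = parent′-leaf none ◅ Γ-≼′ r

    ≼′-base : ∀ {p e} → Γ p ≼′ e → p ≼ base e
    ≼′-base {p} r with ≼′-inv r
    ... | inj₁ refl = subst (p ≼_) (sym (base-Γ p)) ε
    ... | inj₂ (p′ , Γp≡Γp′ , p′≼base) with refl ← injective Γp≡Γp′ = p′≼base

    coversBase : ∀ e v → v ∈ β e → ∃ λ p → p ≼ base e × v ∈ β (Γ p)
    coversBase e v v∈e with preimage? e
    ... | yes (x , refl) = x , ε , v∈e
    ... | no  _          = proj₂ (coversEdges e) v v∈e

    noCycle′ : NoCycle′
    noCycle′ e a≼c with y , refl ← parent′-target e
                   with x , refl , x≼y ← ≼′-Γ a≼c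
                   with y′ , x→y′ , Γy≡Γy′ ← parent′-Γ-inv e
                   with refl ← injective Γy≡Γy′ = noCycle x→y′ x≼y

    forest′ : RootedForest m
    forest′ = record { parent = parent′ ; acyclic = Ancestry.noCycle⇒acyclic parent′ noCycle′ }

    sharedVertex : ∀ {s t w} → w ∈ β s → w ∈ β t →
                   ∃ λ l → l ≼ base s × l ≼ base t × ∃ λ r → r ≼ l × w ∈ β (Γ r)
    sharedVertex {s} {t} {w} w∈s w∈t =
      let q₁ , q₁≼s , w∈q₁             = coversBase s w w∈s
          q₂ , q₂≼t , w∈q₂             = coversBase t w w∈t
          l , (l≼q₁ , l≼q₂ , _) , below = coversOverlaps q₁ q₂ w w∈q₁ w∈q₂
      in l , ≼-trans l≼q₁ q₁≼s , ≼-trans l≼q₂ q₂≼t , below w w∈q₁ w∈q₂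

    common-image : ∀ {s t p′} → s ≢ t → p′ ≼′ s → p′ ≼′ t → ∃ λ p → p′ ≡ Γ p
    common-image s≢t p′≼s p′≼t with ≼′-inv p′≼s | ≼′-inv p′≼t
    ... | inj₂ (p , p′≡Γp , _) | _                    = p , p′≡Γp
    ... | inj₁ _               | inj₂ (p , p′≡Γp , _) = p , p′≡Γp
    ... | inj₁ refl            | inj₁ refl            = ⊥-elim (s≢t refl)

    elimination′ : IsElimination parent′ id
    elimination′ = isElimination cover (λ e → e , λ v v∈e → e , ε , v∈e) coversOverlaps′
      where
      coversOverlaps′ : ∀ s t v → v ∈ β s → v ∈ β t →
                        ∃ λ l → Lcv′ s t l × (∀ w → w ∈ β s → w ∈ β t → ∃ λ p → p ≼′ l × w ∈ β p)
      coversOverlaps′ s t v v∈s v∈t with s Fin.≟ t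
      ... | yes refl = s , (ε , ε , λ _ p≼s _ → p≼s) , λ w w∈s _ → s , ε , w∈s
      ... | no  s≢t with l₀ , l₀≼s , l₀≼t , _ ← sharedVertex v∈s v∈t
                    with L , L≼s , L≼t , greatest ← lcv-exists acyclic l₀≼s l₀≼t =
        Γ L , (base-≼′ L≼s , base-≼′ L≼t , greatest′) , below′
        where
        greatest′ : ∀ p′ → p′ ≼′ s → p′ ≼′ t → p′ ≼′ Γ L
        greatest′ p′ p′≼s p′≼t with p , refl ← common-image s≢t p′≼s p′≼t =
          Γ-≼′ (greatest p (≼′-base p′≼s) (≼′-base p′≼t))

        below′ : ∀ w → w ∈ β s → w ∈ β t → ∃ λ p → p ≼′ Γ L × w ∈ β p
        below′ w w∈s w∈t with l , l≼s , l≼t , r , r≼l , w∈r ← sharedVertex w∈s w∈t =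
          Γ r , Γ-≼′ (≼-trans r≼l (greatest l l≼s l≼t)) , w∈r

    rank-< : ∀ {a c} → Parent′ a c → rank c < rank a
    rank-< {a} e with y , refl ← parent′-target e rewrite rank-Γ y with preimage? a
    ... | yes (x , refl) = let y′ , x→y′ , Γy≡Γy′ = mapMaybe-just (parent x) e in
      subst (λ z → level F z < level F x) (sym (injective Γy≡Γy′)) (level-below-parent x→y′ ε)
    ... | no  _          =
      subst (λ z → level F z < suc (level F (coveringNode a))) (injective (just-injective e)) ℕ.≤-refl

    rank≥1 : ∀ e → 1 ≤ rank e
    rank≥1 e with preimage? e
    ... | yes (x , _) = 1≤level x
    ... | no  _       = s≤s z≤n

    rank≤ : ∀ e → rank e ≤ suc (height F)
    rank≤ e with preimage? e
    ... | yes (x , _) = ℕ.≤-trans (level≤height x) (ℕ.n≤1+n _)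
    ... | no  _       = s≤s (level≤height (coveringNode e))

    height′≤ : height forest′ ≤ suc (height F)
    height′≤ = Forest.height-lub forest′ λ e →
      ℕ.≤-trans (Forest.level≤rank forest′ rank rank≥1 rank-< e) (rank≤ e)

  IsBijective : ElimForest → Set
  IsBijective D = Bijective _≡_ _≡_ (ElimForest.Γ D)

  strictify : (D : ElimForest) → IsInjective D →
              Σ ElimForest λ D′ → IsBijective D′ × elimHeight D′ ≤ suc (elimHeight D)
  strictify (elimForest F Γ elimination) injective =
    elimForest forest′ id elimination′ , Identity.bijective _≡_ , height′≤
    where open Strictification F Γ elimination injective

  module Path where
    parent : Fin m → Maybe (Fin m)
    parent Fin.zero    = nothing
    parent (Fin.suc i) = just (inject₁ i)

    open Ancestry parent

    parent-< : ∀ {a b} → Parent a b → toℕ b < toℕ a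
    parent-< {Fin.suc i} refl = s≤s (ℕ.≤-reflexive (Fin.toℕ-inject₁ i))

    ≼⇒≤ : ∀ {a b} → a ≼ b → toℕ a ≤ toℕ b
    ≼⇒≤ ε       = ℕ.≤-refl
    ≼⇒≤ (e ◅ r) = ℕ.≤-trans (≼⇒≤ r) (ℕ.<⇒≤ (parent-< e))

    ≤⇒≼ : ∀ n {a b} → toℕ b ≡ n → toℕ a ≤ n → a ≼ b
    ≤⇒≼ n {a} {b} b≡n a≤n with toℕ a ℕ.≟ n
    ... | yes a≡n = subst (_≼ b) (Fin.toℕ-injective (trans b≡n (sym a≡n))) ε
    ≤⇒≼ zero    {b = Fin.zero}  _   a≤n | no a≢n = ⊥-elim (a≢n (ℕ.n≤0⇒n≡0 a≤n))
    ≤⇒≼ (suc n) {b = Fin.suc i} b≡n a≤n | no a≢n =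
      refl ◅ ≤⇒≼ n (trans (Fin.toℕ-inject₁ i) (ℕ.suc-injective b≡n)) (ℕ.≤-pred (ℕ.≤∧≢⇒< a≤n a≢n))

    ≼-total : ∀ a b → a ≼ b ⊎ b ≼ a
    ≼-total a b with toℕ a ℕ.≤? toℕ b
    ... | yes a≤b = inj₁ (≤⇒≼ _ refl a≤b)
    ... | no  a≰b = inj₂ (≤⇒≼ _ refl (ℕ.<⇒≤ (ℕ.≰⇒> a≰b)))

    forest : RootedForest m
    forest = record
      { parent  = parent
      ; acyclic = noCycle⇒acyclic λ e a≼b → ℕ.<⇒≱ (parent-< e) (≼⇒≤ a≼b)
      }

    elimination : IsElimination parent id
    elimination = isElimination cover (λ e → e , λ v v∈e → e , ε , v∈e) coversOverlaps
      where
      coversOverlaps : ∀ s t v → v ∈ β s → v ∈ β t →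
                       ∃ λ l → Lcv s t l × (∀ w → w ∈ β s → w ∈ β t → ∃ λ p → p ≼ l × w ∈ β p)
      coversOverlaps s t _ _ _ with ≼-total s t
      ... | inj₁ s≼t = s , (ε , s≼t , λ _ p≼s _ → p≼s) , λ w w∈s _ → s , ε , w∈s
      ... | inj₂ t≼s = t , (t≼s , ε , λ _ _ p≼t → p≼t) , λ w _ w∈t → t , ε , w∈t

  pathForest : ElimForest
  pathForest = elimForest Path.forest id Path.elimination

  IsElimination? : ∀ {k} {parent : Fin k → Maybe (Fin k)} → Ancestry.Acyclic parent →
                   (Γ : Fin k → Fin m) → Dec (IsElimination parent Γ)
  IsElimination? {parent = parent} acyclic Γ =
    map′ (λ (c , e , o) → isElimination c e o) (λ (isElimination c e o) → c , e , o)
         (covers? ×-dec coversEdges? ×-dec coversOverlaps?)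
    where
    open Ancestry parent
    _≼?_ = ≼-dec acyclic
    _∈Γ?_ = λ v t → v ∈? β (Γ t)
    covers?         = Fin.all? λ v → Fin.any? λ t → v ∈Γ? t
    coversEdges?    = Fin.all? λ e → Fin.any? λ t → Fin.all? λ v → (v ∈? β e) →-dec
                        Fin.any? λ p → (p ≼? t) ×-dec (v ∈Γ? p)
    lcv?            = λ s t l → (l ≼? s) ×-dec (l ≼? t) ×-dec
                        Fin.all? λ p → (p ≼? s) →-dec (p ≼? t) →-dec (p ≼? l)
    coversOverlaps? = Fin.all? λ s → Fin.all? λ t → Fin.all? λ v → (v ∈Γ? s) →-dec (v ∈Γ? t) →-dec
                        Fin.any? λ l → lcv? s t l ×-dec
                          Fin.all? λ w → (w ∈Γ? s) →-dec (w ∈Γ? t) →-dec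
                            Fin.any? λ p → (p ≼? l) ×-dec (w ∈Γ? p)

  IsElimination-resp : ∀ {k} {parent parent′ : Fin k → Maybe (Fin k)} {Γ Γ′ : Fin k → Fin m} →
                       parent ≗ parent′ → Γ ≗ Γ′ → IsElimination parent Γ → IsElimination parent′ Γ′
  IsElimination-resp {parent = parent} {parent′} {Γ} {Γ′} parent≗ Γ≗
                     (isElimination covers coversEdges coversOverlaps) =
    isElimination
      (λ v → let t , v∈t = covers v in t , ∈→ v∈t)
      (λ e → let t , below = coversEdges e in
         t , λ v v∈e → let p , p≼t , v∈p = below v v∈e in p , ≼→ p≼t , ∈→ v∈p)
      (λ s t v v∈s v∈t →
         let l , (l≼s , l≼t , greatest) , below = coversOverlaps s t v (∈← v∈s) (∈← v∈t) in
         l , (≼→ l≼s , ≼→ l≼t , λ p p≼s p≼t → ≼→ (greatest p (≼← p≼s) (≼← p≼t))) ,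
         λ w w∈s w∈t → let p , p≼l , w∈p = below w (∈← w∈s) (∈← w∈t) in p , ≼→ p≼l , ∈→ w∈p)
    where
    open Ancestry parent
    open Ancestry parent′ using () renaming (_≼_ to _≼′_)
    ≼→ : ∀ {a b} → a ≼ b → a ≼′ b
    ≼→ = mapStar λ {a} e → trans (sym (parent≗ a)) e
    ≼← : ∀ {a b} → a ≼′ b → a ≼ b
    ≼← = mapStar λ {a} e → trans (parent≗ a) e
    ∈→ : ∀ {w t} → w ∈ β (Γ t) → w ∈ β (Γ′ t)
    ∈→ {t = t} = ∈-β-cong (Γ≗ t)
    ∈← : ∀ {w t} → w ∈ β (Γ′ t) → w ∈ β (Γ t)
    ∈← {t = t} = ∈-β-cong (sym (Γ≗ t))

  module Search (X : ∀ {k} → (Fin k → Fin m) → Set) (X? : ∀ {k} (Γ : Fin k → Fin m) → Dec (X Γ))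
                (X-resp : ∀ {k} {Γ Γ′ : Fin k → Fin m} → Γ ≗ Γ′ → X Γ → X Γ′) where

    Realizable : ℕ → Set
    Realizable d = ∃ λ D → ElimForest.k D ≤ m × elimHeight D ≤ d × X (ElimForest.Γ D)

    rooted : ∀ {k} {parent : Fin k → Maybe (Fin k)} → Ancestry.Acyclic parent → RootedForest k
    rooted {parent = parent} acyclic = record { parent = parent ; acyclic = acyclic }

    Candidate : ℕ → ∀ k → (Fin k → Maybe (Fin k)) → (Fin k → Fin m) → Set
    Candidate d k parent Γ = Σ (Ancestry.Acyclic parent) λ acyclic →
      IsElimination parent Γ × height (rooted acyclic) ≤ d × X Γ

    candidate? : ∀ d k parent Γ → Dec (Candidate d k parent Γ)
    candidate? d k parent Γ with Fin.all? (λ t → ≡-decMaybe Fin._≟_ (anc parent k t) nothing)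
    ... | no  cyclic  = no (cyclic ∘ proj₁)
    ... | yes acyclic =
      map′ (acyclic ,_)
           (λ (acyclic′ , elimination , height≤ , x) →
              elimination ,
              subst (_≤ d) (height-resp {F = rooted acyclic′} {F′ = rooted acyclic} λ _ → refl) height≤ ,
              x)
           (IsElimination? acyclic Γ ×-dec (_ ℕ.≤? d) ×-dec X? Γ)

    candidate-resp-parent : ∀ {d k parent parent′} Γ → parent ≗ parent′ →
                            Candidate d k parent Γ → Candidate d k parent′ Γ
    candidate-resp-parent {k = k} Γ parent≗ (acyclic , elimination , height≤ , x) =
      (λ t → trans (sym (anc-resp parent≗ k t)) (acyclic t)) ,
      IsElimination-resp parent≗ (λ _ → refl) elimination ,
      subst (_≤ _) (height-resp parent≗) height≤ ,
      x

    candidate-resp-Γ : ∀ {d k parent Γ Γ′} → Γ ≗ Γ′ → Candidate d k parent Γ → Candidate d k parent Γ′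
    candidate-resp-Γ Γ≗ (acyclic , elimination , height≤ , x) =
      acyclic , IsElimination-resp (λ _ → refl) Γ≗ elimination , height≤ , X-resp Γ≗ x

    realizable? : ∀ d → Dec (Realizable d)
    realizable? d = map′ from to (ℕ.anyUpTo? (λ k → candidates? k) (suc m))
      where
      candidates? : ∀ k → Dec (∃₂ (Candidate d k))
      candidates? k =
        search-functions (Maybe-searchable Fin.any?) k
          (λ parent≗ (Γ , c) → Γ , candidate-resp-parent Γ parent≗ c)
          (λ parent → search-functions Fin.any? k candidate-resp-Γ (candidate? d k parent))

      from : ∃ (λ k → k < suc m × ∃₂ (Candidate d k)) → Realizable d
      from (k , k<1+m , parent , Γ , acyclic , elimination , height≤ , x) =
        elimForest (rooted acyclic) Γ elimination ,
        ℕ.≤-pred k<1+m , height≤ , x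

      to : Realizable d → ∃ (λ k → k < suc m × ∃₂ (Candidate d k))
      to (elimForest {k} F Γ elimination , k≤m , height≤ , x) =
        k , s≤s k≤m , RootedForest.parent F , Γ , RootedForest.acyclic F , elimination , height≤ , x

    record Optimal (d : ℕ) : Set where
      field
        witness        : ElimForest
        witness-X      : X (ElimForest.Γ witness)
        witness-height : elimHeight witness ≡ d
        minimal        : ∀ D → ElimForest.k D ≤ m → X (ElimForest.Γ D) → d ≤ elimHeight D

    optimal : ∀ D → ElimForest.k D ≤ m → X (ElimForest.Γ D) → ∃ Optimal
    optimal D₀ k≤m x₀ =
      let d , (D , k≤m , height≤d , x) , least-d = least realizable? (D₀ , k≤m , ℕ.≤-refl , x₀)
          minimal = λ D′ k′≤m x′ → least-d (D′ , k′≤m , ℕ.≤-refl , x′)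
      in d , record { witness        = D
                    ; witness-X      = x
                    ; witness-height = ℕ.≤-antisym height≤d (minimal D k≤m x)
                    ; minimal        = minimal
                    }

  module Unrestricted = Search (λ _ → ⊤) (λ _ → yes tt) (λ _ _ → tt)
  module Strict       = Search (Bijective _≡_ _≡_) bijective? bijective-resp

  hd-optimal : ∃ Unrestricted.Optimal
  hd-optimal = Unrestricted.optimal pathForest ℕ.≤-refl tt

  shd-optimal : ∃ Strict.Optimal
  shd-optimal = Strict.optimal pathForest ℕ.≤-refl (Identity.bijective _≡_)

  optimal⇒IsHd : ∀ {d} → Unrestricted.Optimal d → IsHd H d
  optimal⇒IsHd O = (toEliminationForest witness , witness-height) , lower-bound
    where
    open Unrestricted.Optimal O
    lower-bound : ∀ EF → _ ≤ efHeight EF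
    lower-bound EF = let D , injective , height≤ = injectivize (fromEliminationForest EF) in
      ℕ.≤-trans (minimal D (Fin.injective⇒≤ injective) tt) height≤

  optimal⇒IsShd : ∀ {d} → Strict.Optimal d → IsShd H d
  optimal⇒IsShd O =
    (toEliminationForest witness , witness-X , witness-height) ,
    λ EF bijective → minimal (fromEliminationForest EF) (Fin.injective⇒≤ (proj₁ bijective)) bijective
    where open Strict.Optimal O

  hd≤shd : ∀ {hd shd} → Unrestricted.Optimal hd → Strict.Optimal shd → hd ≤ shd
  hd≤shd O O′ =
    subst (_ ≤_) witness-height (Unrestricted.Optimal.minimal O witness (Fin.injective⇒≤ (proj₁ witness-X)) tt)
    where open Strict.Optimal O′

  shd≤1+hd : ∀ {hd shd} → Unrestricted.Optimal hd → Strict.Optimal shd → shd ≤ suc hd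
  shd≤1+hd {hd} {shd} O O′ =
    let D₁ , injective , height₁≤ = injectivize witness
        D₂ , bijective , height₂≤ = strictify D₁ injective
    in begin
      shd                      ≤⟨ Strict.Optimal.minimal O′ D₂ (Fin.injective⇒≤ (proj₁ bijective)) bijective ⟩
      elimHeight D₂            ≤⟨ height₂≤ ⟩
      suc (elimHeight D₁)      ≤⟨ s≤s height₁≤ ⟩
      suc (elimHeight witness) ≡⟨ cong suc witness-height ⟩
      suc hd                   ∎
    where
    open Unrestricted.Optimal O
    open ℕ.≤-Reasoning

theorem2p5 : ∀ (H : Hypergraph) →
    Σ ℕ λ hd → Σ ℕ λ shd →
      IsHd H hd × IsShd H shd × hd ≤ shd × shd ≤ suc hd
theorem2p5 H =
  let hd , O = hd-optimal ; shd , O′ = shd-optimal in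
  hd , shd , optimal⇒IsHd O , optimal⇒IsShd O′ , hd≤shd O O′ , shd≤1+hd O O′
  where open Elimination H
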